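{- As formal power series, $$J_1\,U(q)=\sum_{n=1}^{\infty}\sum_{r=1}^{n}(-1)^{r-1}q^{2n^2-n-r(r-1)/2}(1+q^{2n}).$$
   Context: Let $(a;q)_n=\prod_{j=0}^{n-1}(1-aq^j)$ and $J_1=\prod_{n\ge1}(1-q^{n})$. $U(q)=\sum_{n\ge0}(-q;q)_n^2q^{n+1}=\sum_{n\ge1}u(n)q^n$ is the generating function for the number $u(n)$ of strongly unimodal sequences of size $n$ (sequences $0<a_1<\cdots<a_k>\cdots>a_s>0$ with sum $n$). -}

module Defs where

open import Data.Nat as ℕ using (ℕ; zero; suc; _∸_)
open import Data.Nat.DivMod using (_/_)
open import Data.Integer as ℤ using (ℤ; +_; -_; _+_; _*_)
open import Relation.Nullary.Decidable using (does)
open import Data.Bool using (if_then_else_)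

Series : Set
Series = ℕ → ℤ

sumTo : ℕ → (ℕ → ℤ) → ℤ
sumTo zero    f = f 0
sumTo (suc n) f = sumTo n f + f (suc n)

sum1To : ℕ → (ℕ → ℤ) → ℤ
sum1To zero    f = + 0
sum1To (suc n) f = sum1To n f + f (suc n)

0S : Series
0S _ = + 0

1S : Series
1S zero    = + 1
1S (suc _) = + 0

mono : ℤ → ℕ → Series
mono c e N = if does (e ℕ.≟ N) then c else + 0

_⊕_ : Series → Series → Series
(f ⊕ g) N = f N + g N

_⊛_ : Series → Series → Series
(f ⊛ g) N = sumTo N (λ i → f i * g (N ∸ i))

prodBelow : ℕ → (ℕ → Series) → Series
prodBelow zero    F = 1S
prodBelow (suc n) F = prodBelow n F ⊛ F n

-- q-Pochhammer (a;q)_n with a = c q^e :  Π_{j=0}^{n-1} (1 - c q^{e+j})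
poch : ℤ → ℕ → ℕ → Series
poch c e n = prodBelow n (λ j → 1S ⊕ mono (- c) (e ℕ.+ j))

-- J₁ = Π_{n≥1} (1 - q^n).  The coefficient of q^N only depends on the
-- factors with n ≤ N, so [q^N] J₁ = [q^N] Π_{n=1}^{N} (1 - q^n) = [q^N] (q;q)_N.
J₁ : Series
J₁ N = poch (+ 1) 1 N N

-- U(q) = Σ_{n≥0} (-q;q)_n² q^{n+1}.  The n-th summand has order ≥ n+1,
-- so [q^N] U = Σ_{n=0}^{N} [q^N] (-q;q)_n² q^{n+1}.
U : Series
U N = sumTo N (λ n → ((poch (- + 1) 1 n ⊛ poch (- + 1) 1 n) ⊛ mono (+ 1) (suc n)) N)

sgn : ℕ → ℤ
sgn zero    = + 1
sgn (suc zero) = - + 1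
sgn (suc (suc k)) = sgn k

-- the exponent 2n² - n - r(r-1)/2  (never truncated for 1 ≤ r ≤ n)
expo : ℕ → ℕ → ℕ
expo n r = (2 ℕ.* n ℕ.* n ∸ n) ∸ (r ℕ.* (r ∸ 1)) / 2

-- RHS = Σ_{n≥1} Σ_{r=1}^{n} (-1)^{r-1} q^{2n²-n-r(r-1)/2} (1 + q^{2n}).
-- Every exponent occurring for index n is ≥ n, so only n ≤ N contribute to [q^N].
RHS : Series
RHS N = sum1To N (λ n → sum1To n (λ r →
          (mono (sgn (r ∸ 1)) (expo n r) ⊕ mono (sgn (r ∸ 1)) (expo n r ℕ.+ 2 ℕ.* n)) N))

-- Multiplying in (1 + q^(n+1))² one step at a time gives
--   (-q;q)_n² = Σ_{j ≤ n} q^(j(j+1)/2) [2n+1 choose n-j],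
-- so U = Σ_j q^((j+1)(j+2)/2) G_(2j+1) with G_c = Σ_n q^n [2n+c choose n].  The partial sums of
-- G_c + q^(c+3) G_(c+3) are single Gaussian polynomials [2K+c+3 choose K+1], and
-- (q;q)_a [a+b choose a] = (q^(b+1);q)_a is 1 modulo q^(min(a,b)+1); hence J₁ G_c satisfies
--   f_c + q^(c+3) f_(c+3) = 1,
-- as does the partial theta series Σ_i (-1)^i q^(ic + 3i(i+1)/2), and this recurrence determines f.
-- Thus J₁ U = Σ_{i,j} (-1)^i q^((j+1)(j+2)/2 + i(2j+1) + 3i(i+1)/2), which becomes the right-hand
-- side on writing j = 2m or 2m + 1 and (n, r) = (i + m + 1, i + 1).

module Submission where

open import Defs
open import Relation.Binary.PropositionalEquality using (_≡_)
open import Data.Nat using (ℕ)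

open import Data.Nat as ℕ using (zero; suc; _∸_; z≤n; s≤s)
import Data.Nat.Properties as ℕₚ
open import Data.Nat.DivMod using (_/_; m*n/n≡m)
import Data.Nat.Tactic.RingSolver as ℕ-Solver
open import Data.Integer using (ℤ; +_; -_; _+_; _*_; 0ℤ; 1ℤ; -1ℤ)
import Data.Integer.Properties as ℤₚ
open import Data.Integer.Tactic.RingSolver using (solve-∀)
open import Data.Sum using (inj₁; inj₂)
open import Data.List using (_∷_; [])
open import Algebra.Bundles using (AbelianGroup)
open import Algebra.Properties.CommutativeSemigroup ℤₚ.+-commutativeSemigroup
  using () renaming (interchange to +-interchange; x∙yz≈y∙xz to +-swapFront; xy∙z≈xz∙y to +-swapBack)
open import Algebra.Properties.Group (AbelianGroup.group ℤₚ.+-0-abelianGroup) using () renaming (∙-cancelʳ to +-cancelʳ)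
open import Relation.Binary.Bundles using (Setoid)
import Relation.Binary.Reasoning.Setoid as SetoidReasoning
open import Relation.Binary.PropositionalEquality
  using (_≗_; _→-setoid_; refl; sym; trans; cong; cong₂; module ≡-Reasoning)

-- Finite sums

sumTo-cong≤ : ∀ n {f g : ℕ → ℤ} → (∀ k → k ℕ.≤ n → f k ≡ g k) → sumTo n f ≡ sumTo n g
sumTo-cong≤ zero    f≡g = f≡g 0 z≤n
sumTo-cong≤ (suc n) f≡g =
  cong₂ _+_ (sumTo-cong≤ n (λ k k≤n → f≡g k (ℕₚ.m≤n⇒m≤1+n k≤n))) (f≡g (suc n) ℕₚ.≤-refl)

sumTo-cong : ∀ n {f g : ℕ → ℤ} → f ≗ g → sumTo n f ≡ sumTo n g
sumTo-cong n f≗g = sumTo-cong≤ n (λ k _ → f≗g k)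

sumTo-+ : ∀ n (f g : ℕ → ℤ) → sumTo n (λ k → f k + g k) ≡ sumTo n f + sumTo n g
sumTo-+ zero    f g = refl
sumTo-+ (suc n) f g = trans (cong (_+ (f (suc n) + g (suc n))) (sumTo-+ n f g))
                            (+-interchange (sumTo n f) (sumTo n g) (f (suc n)) (g (suc n)))

sumTo-*ˡ : ∀ n c (f : ℕ → ℤ) → sumTo n (λ k → c * f k) ≡ c * sumTo n f
sumTo-*ˡ zero    c f = refl
sumTo-*ˡ (suc n) c f = trans (cong (_+ (c * f (suc n))) (sumTo-*ˡ n c f))
                             (sym (ℤₚ.*-distribˡ-+ c (sumTo n f) (f (suc n))))

sumTo-neg : ∀ n (f : ℕ → ℤ) → sumTo n (λ k → - f k) ≡ - sumTo n f
sumTo-neg zero    f = refl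
sumTo-neg (suc n) f = trans (cong (_+ (- f (suc n))) (sumTo-neg n f))
                            (sym (ℤₚ.neg-distrib-+ (sumTo n f) (f (suc n))))

sumTo-zero : ∀ n (f : ℕ → ℤ) → (∀ k → k ℕ.≤ n → f k ≡ 0ℤ) → sumTo n f ≡ 0ℤ
sumTo-zero zero    f f≡0 = f≡0 0 z≤n
sumTo-zero (suc n) f f≡0 =
  cong₂ _+_ (sumTo-zero n f (λ k k≤n → f≡0 k (ℕₚ.m≤n⇒m≤1+n k≤n))) (f≡0 (suc n) ℕₚ.≤-refl)

sumTo-head : ∀ n (f : ℕ → ℤ) → sumTo (suc n) f ≡ f 0 + sumTo n (λ k → f (suc k))
sumTo-head zero    f = refl
sumTo-head (suc n) f = trans (cong (_+ f (suc (suc n))) (sumTo-head n f))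
                             (ℤₚ.+-assoc (f 0) (sumTo n (λ k → f (suc k))) (f (suc (suc n))))

sumTo-exchange : ∀ n m (h : ℕ → ℕ → ℤ) →
                 sumTo n (λ i → sumTo m (h i)) ≡ sumTo m (λ k → sumTo n (λ i → h i k))
sumTo-exchange zero    m h = refl
sumTo-exchange (suc n) m h =
  trans (cong (_+ sumTo m (h (suc n))) (sumTo-exchange n m h))
        (sym (sumTo-+ m (λ k → sumTo n (λ i → h i k)) (h (suc n))))

sumTo-extend : ∀ {n m} (f : ℕ → ℤ) → n ℕ.≤ m → (∀ k → n ℕ.< k → f k ≡ 0ℤ) →
               sumTo m f ≡ sumTo n f
sumTo-extend {n} f n≤m tail≡0 =
  trans (cong (λ m → sumTo m f) (sym (ℕₚ.m∸n+n≡m n≤m))) (extend (_ ∸ n))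
  where
  extend : ∀ d → sumTo (d ℕ.+ n) f ≡ sumTo n f
  extend zero    = refl
  extend (suc d) = trans (cong₂ _+_ (extend d) (tail≡0 _ (s≤s (ℕₚ.m≤n+m n d))))
                         (ℤₚ.+-identityʳ _)

sumTo-reverse : ∀ n (f : ℕ → ℤ) → sumTo n f ≡ sumTo n (λ i → f (n ∸ i))
sumTo-reverse zero    f = refl
sumTo-reverse (suc n) f = begin
  sumTo n f + f (suc n)                   ≡⟨ cong (_+ f (suc n)) (sumTo-reverse n f) ⟩
  sumTo n (λ i → f (n ∸ i)) + f (suc n)   ≡⟨ ℤₚ.+-comm _ (f (suc n)) ⟩
  f (suc n) + sumTo n (λ i → f (n ∸ i))   ≡⟨ sym (sumTo-head n (λ i → f (suc n ∸ i))) ⟩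
  sumTo (suc n) (λ i → f (suc n ∸ i))     ∎
  where open ≡-Reasoning

sumTo-antidiagonal : ∀ n (h : ℕ → ℕ → ℤ) →
  sumTo n (λ k → sumTo k (λ j → h j (k ∸ j))) ≡ sumTo n (λ j → sumTo (n ∸ j) (h j))
sumTo-antidiagonal zero    h = refl
sumTo-antidiagonal (suc n) h = begin
  sumTo n (λ k → sumTo k (λ j → h j (k ∸ j))) + (sumTo n (λ j → h j (suc n ∸ j)) + h (suc n) (n ∸ n))
    ≡⟨ cong₂ (λ u v → u + (sumTo n (λ j → h j (suc n ∸ j)) + v))
             (sumTo-antidiagonal n h) (cong (h (suc n)) (ℕₚ.n∸n≡0 n)) ⟩
  sumTo n (λ j → sumTo (n ∸ j) (h j)) + (sumTo n (λ j → h j (suc n ∸ j)) + h (suc n) 0)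
    ≡⟨ sym (ℤₚ.+-assoc (sumTo n (λ j → sumTo (n ∸ j) (h j))) (sumTo n (λ j → h j (suc n ∸ j))) (h (suc n) 0)) ⟩
  (sumTo n (λ j → sumTo (n ∸ j) (h j)) + sumTo n (λ j → h j (suc n ∸ j))) + h (suc n) 0
    ≡⟨ cong (_+ h (suc n) 0) (trans (sym (sumTo-+ n _ _)) (sumTo-cong≤ n rowGrows)) ⟩
  sumTo n (λ j → sumTo (suc n ∸ j) (h j)) + h (suc n) 0
    ≡⟨ cong (λ m → sumTo n (λ j → sumTo (suc n ∸ j) (h j)) + sumTo m (h (suc n))) (sym (ℕₚ.n∸n≡0 n)) ⟩
  sumTo n (λ j → sumTo (suc n ∸ j) (h j)) + sumTo (n ∸ n) (h (suc n))
    ∎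
  where
  open ≡-Reasoning
  rowGrows : ∀ j → j ℕ.≤ n → sumTo (n ∸ j) (h j) + h j (suc n ∸ j) ≡ sumTo (suc n ∸ j) (h j)
  rowGrows j j≤n rewrite ℕₚ.+-∸-assoc 1 j≤n = refl

sumTo-pairs : ∀ m (f : ℕ → ℤ) →
              sumTo m (λ k → f (k ℕ.+ k) + f (suc (k ℕ.+ k))) ≡ sumTo (suc (m ℕ.+ m)) f
sumTo-pairs zero    f = refl
sumTo-pairs (suc m) f rewrite ℕₚ.+-suc m m =
  trans (cong (_+ (f (suc (suc (m ℕ.+ m))) + f (suc (suc (suc (m ℕ.+ m)))))) (sumTo-pairs m f))
        (sym (ℤₚ.+-assoc (sumTo (suc (m ℕ.+ m)) f) (f (suc (suc (m ℕ.+ m)))) (f (suc (suc (suc (m ℕ.+ m)))))))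

sum1To-suc : ∀ n (f : ℕ → ℤ) → sum1To (suc n) f ≡ sumTo n (λ k → f (suc k))
sum1To-suc zero    f = ℤₚ.+-identityˡ (f 1)
sum1To-suc (suc n) f = cong (_+ f (suc (suc n))) (sum1To-suc n f)

-- The ring of formal power series

open Setoid (ℕ →-setoid ℤ) using () renaming (refl to ≗-refl; sym to ≗-sym; trans to ≗-trans)
module ≗-Reasoning = SetoidReasoning (ℕ →-setoid ℤ)

shift : ℕ → Series → Series
shift zero    f         = f
shift (suc k) f zero    = 0ℤ
shift (suc k) f (suc N) = shift k f N

neg : Series → Series
neg f N = - f N

infix 20 _⊖_
_⊖_ : Series → Series → Series
f ⊖ g = f ⊕ neg g

infixr 25 _·_
_·_ : ℤ → Series → Series
(c · f) N = c * f N

tail : Series → Series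
tail f N = f (suc N)

⊕-cong : ∀ {f f′ g g′} → f ≗ f′ → g ≗ g′ → f ⊕ g ≗ f′ ⊕ g′
⊕-cong f≗f′ g≗g′ N = cong₂ _+_ (f≗f′ N) (g≗g′ N)

·-cong : ∀ c {f g} → f ≗ g → c · f ≗ c · g
·-cong c f≗g N = cong (c *_) (f≗g N)

shift-cong : ∀ k {f g} → f ≗ g → shift k f ≗ shift k g
shift-cong zero    f≗g N       = f≗g N
shift-cong (suc k) f≗g zero    = refl
shift-cong (suc k) f≗g (suc N) = shift-cong k f≗g N

shift-cong≤ : ∀ k N {f g} → (∀ t → t ℕ.+ k ℕ.≤ N → f t ≡ g t) → shift k f N ≡ shift k g N
shift-cong≤ zero    N       f≡g = f≡g N (ℕₚ.≤-reflexive (ℕₚ.+-identityʳ N))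
shift-cong≤ (suc k) zero    f≡g = refl
shift-cong≤ (suc k) (suc N) f≡g =
  shift-cong≤ k N (λ t t+k≤N → f≡g t (ℕₚ.≤-trans (ℕₚ.≤-reflexive (ℕₚ.+-suc t k)) (s≤s t+k≤N)))

shift-below : ∀ k f N → N ℕ.< k → shift k f N ≡ 0ℤ
shift-below (suc k) f zero    _         = refl
shift-below (suc k) f (suc N) (s≤s N<k) = shift-below k f N N<k

shift-0S : ∀ k → shift k 0S ≗ 0S
shift-0S zero    N       = refl
shift-0S (suc k) zero    = refl
shift-0S (suc k) (suc N) = shift-0S k N

shift-⊕ : ∀ k f g → shift k (f ⊕ g) ≗ shift k f ⊕ shift k g
shift-⊕ zero    f g N       = refl
shift-⊕ (suc k) f g zero    = refl
shift-⊕ (suc k) f g (suc N) = shift-⊕ k f g N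

shift-neg : ∀ k f → shift k (neg f) ≗ neg (shift k f)
shift-neg zero    f N       = refl
shift-neg (suc k) f zero    = refl
shift-neg (suc k) f (suc N) = shift-neg k f N

shift-· : ∀ k c f → shift k (c · f) ≗ c · shift k f
shift-· zero    c f N       = refl
shift-· (suc k) c f zero    = sym (ℤₚ.*-zeroʳ c)
shift-· (suc k) c f (suc N) = shift-· k c f N

shift-shift : ∀ a b f → shift a (shift b f) ≗ shift (a ℕ.+ b) f
shift-shift zero    b f N       = refl
shift-shift (suc a) b f zero    = refl
shift-shift (suc a) b f (suc N) = shift-shift a b f N

shift-≡ : ∀ {k k′} f → k ≡ k′ → shift k f ≗ shift k′ f
shift-≡ f refl = ≗-refl

shift-shift-≡ : ∀ a b c d f → a ℕ.+ b ≡ c ℕ.+ d → shift a (shift b f) ≗ shift c (shift d f)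
shift-shift-≡ a b c d f a+b≡c+d =
  ≗-trans (shift-shift a b f) (≗-trans (shift-≡ f a+b≡c+d) (≗-sym (shift-shift c d f)))

⊛-cong≤ʳ : ∀ N f {g g′} → (∀ t → t ℕ.≤ N → g t ≡ g′ t) → (f ⊛ g) N ≡ (f ⊛ g′) N
⊛-cong≤ʳ N f g≡g′ = sumTo-cong N (λ i → cong (f i *_) (g≡g′ (N ∸ i) (ℕₚ.m∸n≤m N i)))

⊛-cong≤ˡ : ∀ N {f f′} g → (∀ t → t ℕ.≤ N → f t ≡ f′ t) → (f ⊛ g) N ≡ (f′ ⊛ g) N
⊛-cong≤ˡ N g f≡f′ = sumTo-cong≤ N (λ i i≤N → cong (_* g (N ∸ i)) (f≡f′ i i≤N))

⊛-cong : ∀ {f f′ g g′} → f ≗ f′ → g ≗ g′ → f ⊛ g ≗ f′ ⊛ g′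
⊛-cong {f′ = f′} {g} f≗f′ g≗g′ N =
  trans (⊛-cong≤ˡ N g (λ t _ → f≗f′ t)) (⊛-cong≤ʳ N f′ (λ t _ → g≗g′ t))

⊛-distribˡ-⊕ : ∀ f g h → f ⊛ (g ⊕ h) ≗ (f ⊛ g) ⊕ (f ⊛ h)
⊛-distribˡ-⊕ f g h N =
  trans (sumTo-cong N (λ i → ℤₚ.*-distribˡ-+ (f i) (g (N ∸ i)) (h (N ∸ i)))) (sumTo-+ N _ _)

⊛-distribʳ-⊕ : ∀ f g h → (f ⊕ g) ⊛ h ≗ (f ⊛ h) ⊕ (g ⊛ h)
⊛-distribʳ-⊕ f g h N =
  trans (sumTo-cong N (λ i → ℤₚ.*-distribʳ-+ (h (N ∸ i)) (f i) (g i))) (sumTo-+ N _ _)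

·-⊛ : ∀ c f g → (c · f) ⊛ g ≗ c · (f ⊛ g)
·-⊛ c f g N = trans (sumTo-cong N (λ i → ℤₚ.*-assoc c (f i) (g (N ∸ i)))) (sumTo-*ˡ N c _)

⊛-· : ∀ c f g → f ⊛ (c · g) ≗ c · (f ⊛ g)
⊛-· c f g N = trans (sumTo-cong N (λ i → leftComm (f i) c (g (N ∸ i)))) (sumTo-*ˡ N c _)
  where
  leftComm : ∀ x y z → x * (y * z) ≡ y * (x * z)
  leftComm = solve-∀

⊛-comm : ∀ f g → f ⊛ g ≗ g ⊛ f
⊛-comm f g N = trans (sumTo-reverse N (λ i → f i * g (N ∸ i))) (sumTo-cong≤ N swapFactors)
  where
  swapFactors : ∀ i → i ℕ.≤ N → f (N ∸ i) * g (N ∸ (N ∸ i)) ≡ g i * f (N ∸ i)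
  swapFactors i i≤N rewrite ℕₚ.m∸[m∸n]≡n i≤N = ℤₚ.*-comm (f (N ∸ i)) (g i)

⊛-identityˡ : ∀ f → 1S ⊛ f ≗ f
⊛-identityˡ f zero    = ℤₚ.*-identityˡ (f 0)
⊛-identityˡ f (suc N) = begin
  (1S ⊛ f) (suc N)                                   ≡⟨ sumTo-head N _ ⟩
  + 1 * f (suc N) + sumTo N (λ i → 0ℤ * f (N ∸ i))   ≡⟨ cong₂ _+_ (ℤₚ.*-identityˡ (f (suc N)))
                                                                 (sumTo-zero N _ (λ _ _ → refl)) ⟩
  f (suc N) + 0ℤ                                     ≡⟨ ℤₚ.+-identityʳ (f (suc N)) ⟩
  f (suc N)                                          ∎
  where open ≡-Reasoning

⊛-identityʳ : ∀ f → f ⊛ 1S ≗ f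
⊛-identityʳ f = ≗-trans (⊛-comm f 1S) (⊛-identityˡ f)

shift-⊛ : ∀ k f g → shift k f ⊛ g ≗ shift k (f ⊛ g)
shift-⊛ zero    f g N       = refl
shift-⊛ (suc k) f g zero    = refl
shift-⊛ (suc k) f g (suc N) =
  trans (sumTo-head N _) (trans (ℤₚ.+-identityˡ _) (shift-⊛ k f g N))

⊛-shift : ∀ k f g → f ⊛ shift k g ≗ shift k (f ⊛ g)
⊛-shift k f g = ≗-trans (⊛-comm f (shift k g)) (≗-trans (shift-⊛ k g f) (shift-cong k (⊛-comm g f)))

⊛-unfoldˡ : ∀ f g → f ⊛ g ≗ (f 0 · g) ⊕ shift 1 (tail f ⊛ g)
⊛-unfoldˡ f g zero    = sym (ℤₚ.+-identityʳ _)
⊛-unfoldˡ f g (suc N) = sumTo-head N _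

⊛-assoc : ∀ f g h → (f ⊛ g) ⊛ h ≗ f ⊛ (g ⊛ h)
⊛-assoc f g h N = begin
  ((f ⊛ g) ⊛ h) N
    ≡⟨ ⊛-cong (⊛-unfoldˡ f g) (≗-refl {h}) N ⟩
  (((f 0 · g) ⊕ shift 1 (tail f ⊛ g)) ⊛ h) N
    ≡⟨ ≗-trans (⊛-distribʳ-⊕ (f 0 · g) (shift 1 (tail f ⊛ g)) h)
               (⊕-cong (·-⊛ (f 0) g h) (shift-⊛ 1 (tail f ⊛ g) h)) N ⟩
  ((f 0 · (g ⊛ h)) ⊕ shift 1 ((tail f ⊛ g) ⊛ h)) N
    ≡⟨ cong (λ x → f 0 * (g ⊛ h) N + x) (assocTail N) ⟩
  ((f 0 · (g ⊛ h)) ⊕ shift 1 (tail f ⊛ (g ⊛ h))) N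
    ≡⟨ sym (⊛-unfoldˡ f (g ⊛ h) N) ⟩
  (f ⊛ (g ⊛ h)) N ∎
  where
  open ≡-Reasoning
  assocTail : ∀ N → shift 1 ((tail f ⊛ g) ⊛ h) N ≡ shift 1 (tail f ⊛ (g ⊛ h)) N
  assocTail zero    = refl
  assocTail (suc N) = ⊛-assoc (tail f) g h N

-- Monomials and q-Pochhammer symbols

mono-as-shift : ∀ c e → mono c e ≗ c · shift e 1S
mono-as-shift c zero    zero    = sym (ℤₚ.*-identityʳ c)
mono-as-shift c zero    (suc N) = sym (ℤₚ.*-zeroʳ c)
mono-as-shift c (suc e) zero    = sym (ℤₚ.*-zeroʳ c)
mono-as-shift c (suc e) (suc N) = mono-as-shift c e N

mono-below : ∀ c e N → N ℕ.< e → mono c e N ≡ 0ℤ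
mono-below c e N N<e =
  trans (mono-as-shift c e N) (trans (cong (c *_) (shift-below e 1S N N<e)) (ℤₚ.*-zeroʳ c))

mono-neg : ∀ c e → mono (- c) e ≗ neg (mono c e)
mono-neg c e N = trans (mono-as-shift (- c) e N)
  (trans (sym (ℤₚ.neg-distribˡ-* c (shift e 1S N))) (cong -_ (sym (mono-as-shift c e N))))

mono-shift : ∀ c k e → mono c (k ℕ.+ e) ≗ shift k (mono c e)
mono-shift c k e = begin
  mono c (k ℕ.+ e)             ≈⟨ mono-as-shift c (k ℕ.+ e) ⟩
  c · shift (k ℕ.+ e) 1S       ≈⟨ ·-cong c (≗-sym (shift-shift k e 1S)) ⟩
  c · shift k (shift e 1S)     ≈⟨ ≗-sym (shift-· k c (shift e 1S)) ⟩
  shift k (c · shift e 1S)     ≈⟨ shift-cong k (≗-sym (mono-as-shift c e)) ⟩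
  shift k (mono c e)           ∎
  where open ≗-Reasoning

⊛-mono : ∀ f c e → f ⊛ mono c e ≗ c · shift e f
⊛-mono f c e = begin
  f ⊛ mono c e                 ≈⟨ ⊛-cong (≗-refl {f}) (mono-as-shift c e) ⟩
  f ⊛ (c · shift e 1S)         ≈⟨ ⊛-· c f (shift e 1S) ⟩
  c · (f ⊛ shift e 1S)         ≈⟨ ·-cong c (⊛-shift e f 1S) ⟩
  c · shift e (f ⊛ 1S)         ≈⟨ ·-cong c (shift-cong e (⊛-identityʳ f)) ⟩
  c · shift e f                ∎
  where open ≗-Reasoning

⊛-binomial : ∀ f c e → f ⊛ (1S ⊕ mono c e) ≗ f ⊕ c · shift e f
⊛-binomial f c e = ≗-trans (⊛-distribˡ-⊕ f 1S (mono c e)) (⊕-cong (⊛-identityʳ f) (⊛-mono f c e))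

poch-suc-below : ∀ c e n t → t ℕ.< e ℕ.+ n → poch c e (suc n) t ≡ poch c e n t
poch-suc-below c e n t t<e+n = begin
  poch c e (suc n) t                                        ≡⟨ ⊛-binomial (poch c e n) (- c) (e ℕ.+ n) t ⟩
  poch c e n t + - c * shift (e ℕ.+ n) (poch c e n) t       ≡⟨ cong (λ x → poch c e n t + - c * x)
                                                                    (shift-below (e ℕ.+ n) _ t t<e+n) ⟩
  poch c e n t + - c * 0ℤ                                   ≡⟨ cong (λ x → poch c e n t + x) (ℤₚ.*-zeroʳ (- c)) ⟩
  poch c e n t + 0ℤ                                         ≡⟨ ℤₚ.+-identityʳ _ ⟩
  poch c e n t                                              ∎
  where open ≡-Reasoning

poch-below : ∀ c e n t → t ℕ.< e → poch c e n t ≡ 1S t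
poch-below c e zero    t t<e = refl
poch-below c e (suc n) t t<e =
  trans (poch-suc-below c e n t (ℕₚ.<-≤-trans t<e (ℕₚ.m≤m+n e n))) (poch-below c e n t t<e)

poch-stable : ∀ c e d n t → t ℕ.< e ℕ.+ n → poch c e (d ℕ.+ n) t ≡ poch c e n t
poch-stable c e zero    n t t<e+n = refl
poch-stable c e (suc d) n t t<e+n =
  trans (poch-suc-below c e (d ℕ.+ n) t (ℕₚ.<-≤-trans t<e+n (ℕₚ.+-monoʳ-≤ e (ℕₚ.m≤n+m n d))))
        (poch-stable c e d n t t<e+n)

J₁-truncate : ∀ a t → t ℕ.≤ a → J₁ t ≡ poch (+ 1) 1 a t
J₁-truncate a t t≤a rewrite sym (ℕₚ.m∸n+n≡m t≤a) =
  sym (poch-stable (+ 1) 1 (a ∸ t) t t (s≤s ℕₚ.≤-refl))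

-- Gaussian polynomials

-- gauss a b is the q-binomial coefficient [a + b choose a], defined by the q-Pascal rule.
gauss : ℕ → ℕ → Series
gauss zero    b       = 1S
gauss (suc a) zero    = 1S
gauss (suc a) (suc b) = gauss a (suc b) ⊕ shift (suc a) (gauss (suc a) b)

gauss-≡ : ∀ {a a′ b b′} → a ≡ a′ → b ≡ b′ → gauss a b ≗ gauss a′ b′
gauss-≡ refl refl = ≗-refl

gauss-zeroʳ : ∀ a → gauss a zero ≗ 1S
gauss-zeroʳ zero    = ≗-refl
gauss-zeroʳ (suc a) = ≗-refl

gauss-pascal′-zero : ∀ b → gauss 1 (suc b) ≗ shift (suc b) 1S ⊕ gauss 1 b
gauss-pascal′-zero zero    N = ℤₚ.+-comm (1S N) (shift 1 1S N)
gauss-pascal′-zero (suc b) N = begin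
  1S N + shift 1 (gauss 1 (suc b)) N
    ≡⟨ cong (_+_ (1S N)) (shift-cong 1 (gauss-pascal′-zero b) N) ⟩
  1S N + shift 1 (shift (suc b) 1S ⊕ gauss 1 b) N
    ≡⟨ cong (_+_ (1S N)) (trans (shift-⊕ 1 (shift (suc b) 1S) (gauss 1 b) N)
                                (cong (_+ shift 1 (gauss 1 b) N) (shift-shift 1 (suc b) 1S N))) ⟩
  1S N + (shift (suc (suc b)) 1S N + shift 1 (gauss 1 b) N)
    ≡⟨ +-swapFront (1S N) (shift (suc (suc b)) 1S N) (shift 1 (gauss 1 b) N) ⟩
  shift (suc (suc b)) 1S N + gauss 1 (suc b) N ∎
  where open ≡-Reasoning

gauss-pascal′-one : ∀ a → gauss (suc a) 1 ≗ shift 1 (gauss a 1) ⊕ 1S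
gauss-pascal′-one zero    N = ℤₚ.+-comm (1S N) (shift 1 1S N)
gauss-pascal′-one (suc a) N = begin
  gauss (suc a) 1 N + shift (suc (suc a)) 1S N
    ≡⟨ cong (_+ shift (suc (suc a)) 1S N) (gauss-pascal′-one a N) ⟩
  (shift 1 (gauss a 1) N + 1S N) + shift (suc (suc a)) 1S N
    ≡⟨ +-swapBack (shift 1 (gauss a 1) N) (1S N) (shift (suc (suc a)) 1S N) ⟩
  (shift 1 (gauss a 1) N + shift (suc (suc a)) 1S N) + 1S N
    ≡⟨ cong (_+ 1S N) (sym (trans (shift-⊕ 1 (gauss a 1) (shift (suc a) 1S) N)
                                  (cong (_+_ (shift 1 (gauss a 1) N)) (shift-shift 1 (suc a) 1S N)))) ⟩
  shift 1 (gauss (suc a) 1) N + 1S N ∎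
  where open ≡-Reasoning

gauss-pascal′ : ∀ a b → gauss (suc a) (suc b) ≗ shift (suc b) (gauss a (suc b)) ⊕ gauss (suc a) b
gauss-pascal′ zero    b       = gauss-pascal′-zero b
gauss-pascal′ (suc a) zero    = gauss-pascal′-one (suc a)
gauss-pascal′ (suc a) (suc b) N = begin
  gauss (suc a) (suc (suc b)) N + shift (suc (suc a)) (gauss (suc (suc a)) (suc b)) N
    ≡⟨ cong₂ _+_ (gauss-pascal′ a (suc b) N)
                 (trans (shift-cong (suc (suc a)) (gauss-pascal′ (suc a) b) N) (shift-⊕ (suc (suc a)) _ _ N)) ⟩
  (X₁ + X₂) + (shift (suc (suc a)) (shift (suc b) (gauss (suc a) (suc b))) N + X₄)
    ≡⟨ cong (λ y → (X₁ + X₂) + (y + X₄)) (shift-shift-≡ (suc (suc a)) (suc b) (suc (suc b)) (suc a) _ exponents N) ⟩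
  (X₁ + X₂) + (Y + X₄)
    ≡⟨ +-interchange X₁ X₂ Y X₄ ⟩
  (X₁ + Y) + (X₂ + X₄)
    ≡⟨ cong (_+ (X₂ + X₄)) (sym (shift-⊕ (suc (suc b)) (gauss a (suc (suc b))) _ N)) ⟩
  shift (suc (suc b)) (gauss (suc a) (suc (suc b))) N + gauss (suc (suc a)) (suc b) N ∎
  where
  open ≡-Reasoning
  X₁ = shift (suc (suc b)) (gauss a (suc (suc b))) N
  X₂ = gauss (suc a) (suc b) N
  X₄ = shift (suc (suc a)) (gauss (suc (suc a)) b) N
  Y  = shift (suc (suc b)) (shift (suc a) (gauss (suc a) (suc b))) N
  exponents : suc (suc a) ℕ.+ suc b ≡ suc (suc b) ℕ.+ suc a
  exponents = ℕ-Solver.solve (a ∷ b ∷ [])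

gauss-sym : ∀ a b → gauss a b ≗ gauss b a
gauss-sym zero    b       = ≗-sym (gauss-zeroʳ b)
gauss-sym (suc a) zero    = ≗-refl
gauss-sym (suc a) (suc b) N = begin
  gauss a (suc b) N + shift (suc a) (gauss (suc a) b) N
    ≡⟨ cong₂ _+_ (gauss-sym a (suc b) N) (shift-cong (suc a) (gauss-sym (suc a) b) N) ⟩
  gauss (suc b) a N + shift (suc a) (gauss b (suc a)) N
    ≡⟨ ℤₚ.+-comm (gauss (suc b) a N) _ ⟩
  shift (suc a) (gauss b (suc a)) N + gauss (suc b) a N
    ≡⟨ sym (gauss-pascal′ b a N) ⟩
  gauss (suc b) (suc a) N ∎
  where open ≡-Reasoning

gauss-⊛-factor : ∀ a b → gauss (suc a) b ⊛ (1S ⊕ mono -1ℤ (suc a)) ≗ gauss a b ⊛ (1S ⊕ mono -1ℤ (suc b ℕ.+ a))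
gauss-⊛-factor a zero    = ⊛-cong (≗-sym (gauss-zeroʳ a)) (≗-refl {1S ⊕ mono -1ℤ (suc a)})
gauss-⊛-factor a (suc b) N = begin
  (X ⊛ (1S ⊕ mono -1ℤ (suc a))) N
    ≡⟨ ⊛-binomial X -1ℤ (suc a) N ⟩
  X N + -1ℤ * shift (suc a) X N
    ≡⟨ cong (λ x → X N + -1ℤ * x) (trans (shift-cong (suc a) (gauss-pascal′ a b) N) (shift-⊕ (suc a) _ Y N)) ⟩
  (gauss a (suc b) N + shift (suc a) Y N) + -1ℤ * (shift (suc a) (shift (suc b) (gauss a (suc b))) N + shift (suc a) Y N)
    ≡⟨ cong (λ x → (gauss a (suc b) N + shift (suc a) Y N) + -1ℤ * (x + shift (suc a) Y N))
            (shift-shift-≡ (suc a) (suc b) (suc (suc b) ℕ.+ a) 0 _ exponents N) ⟩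
  (gauss a (suc b) N + shift (suc a) Y N) + -1ℤ * (shift (suc (suc b) ℕ.+ a) (gauss a (suc b)) N + shift (suc a) Y N)
    ≡⟨ cancel (gauss a (suc b) N) (shift (suc a) Y N) _ ⟩
  gauss a (suc b) N + -1ℤ * shift (suc (suc b) ℕ.+ a) (gauss a (suc b)) N
    ≡⟨ sym (⊛-binomial (gauss a (suc b)) -1ℤ (suc (suc b) ℕ.+ a) N) ⟩
  (gauss a (suc b) ⊛ (1S ⊕ mono -1ℤ (suc (suc b) ℕ.+ a))) N ∎
  where
  open ≡-Reasoning
  X = gauss (suc a) (suc b)
  Y = gauss (suc a) b
  exponents : suc a ℕ.+ suc b ≡ (suc (suc b) ℕ.+ a) ℕ.+ 0
  exponents = ℕ-Solver.solve (a ∷ b ∷ [])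
  cancel : ∀ x y z → (x + y) + -1ℤ * (z + y) ≡ x + -1ℤ * z
  cancel = solve-∀

poch-⊛-gauss : ∀ a b → poch (+ 1) 1 a ⊛ gauss a b ≗ poch (+ 1) (suc b) a
poch-⊛-gauss zero    b = ⊛-identityˡ 1S
poch-⊛-gauss (suc a) b = begin
  (Q ⊛ F) ⊛ gauss (suc a) b     ≈⟨ ⊛-assoc Q F (gauss (suc a) b) ⟩
  Q ⊛ (F ⊛ gauss (suc a) b)     ≈⟨ ⊛-cong (≗-refl {Q}) (⊛-comm F (gauss (suc a) b)) ⟩
  Q ⊛ (gauss (suc a) b ⊛ F)     ≈⟨ ⊛-cong (≗-refl {Q}) (gauss-⊛-factor a b) ⟩
  Q ⊛ (gauss a b ⊛ G)           ≈⟨ ≗-sym (⊛-assoc Q (gauss a b) G) ⟩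
  (Q ⊛ gauss a b) ⊛ G           ≈⟨ ⊛-cong (poch-⊛-gauss a b) (≗-refl {G}) ⟩
  poch (+ 1) (suc b) a ⊛ G      ∎
  where
  open ≗-Reasoning
  Q = poch (+ 1) 1 a
  F = 1S ⊕ mono -1ℤ (suc a)
  G = 1S ⊕ mono -1ℤ (suc b ℕ.+ a)

J₁-⊛-gauss : ∀ a b N → N ℕ.≤ a → N ℕ.≤ b → (J₁ ⊛ gauss a b) N ≡ 1S N
J₁-⊛-gauss a b N N≤a N≤b = begin
  (J₁ ⊛ gauss a b) N                    ≡⟨ ⊛-cong≤ˡ N (gauss a b) (λ t t≤N → J₁-truncate a t (ℕₚ.≤-trans t≤N N≤a)) ⟩
  (poch (+ 1) 1 a ⊛ gauss a b) N        ≡⟨ poch-⊛-gauss a b N ⟩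
  poch (+ 1) (suc b) a N                ≡⟨ poch-below (+ 1) (suc b) a N (s≤s N≤b) ⟩
  1S N                                  ∎
  where open ≡-Reasoning

-- gaussPred a b is [a + b - 1 choose a - 1], which vanishes for a = 0.
gaussPred : ℕ → ℕ → Series
gaussPred zero    b = 0S
gaussPred (suc a) b = gauss a b

gaussPred-≡ : ∀ {a a′ b b′} → a ≡ a′ → b ≡ b′ → gaussPred a b ≗ gaussPred a′ b′
gaussPred-≡ refl refl = ≗-refl

gauss-pascal-pred : ∀ a b → gauss a (suc b) ≗ gaussPred a (suc b) ⊕ shift a (gauss a b)
gauss-pascal-pred zero    b N = sym (ℤₚ.+-identityˡ (1S N))
gauss-pascal-pred (suc a) b   = ≗-refl

gauss-split : ∀ a c → gauss (suc a) (suc (suc c)) ≗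
  (shift (suc (suc c)) (gaussPred a (suc (suc c))) ⊕ (gauss a (suc c) ⊕ shift (suc (suc (a ℕ.+ c))) (gauss a (suc c))))
    ⊕ shift (suc a) (gauss (suc a) c)
gauss-split a c N = begin
  gauss (suc a) (suc (suc c)) N
    ≡⟨ gauss-pascal′ a (suc c) N ⟩
  shift (suc (suc c)) (gauss a (suc (suc c))) N + (gauss a (suc c) N + Z)
    ≡⟨ cong (_+ (gauss a (suc c) N + Z)) (trans (shift-cong (suc (suc c)) (gauss-pascal-pred a (suc c)) N)
                                                (shift-⊕ (suc (suc c)) (gaussPred a (suc (suc c))) _ N)) ⟩
  (P + shift (suc (suc c)) (shift a (gauss a (suc c))) N) + (gauss a (suc c) N + Z)
    ≡⟨ cong (λ x → (P + x) + (gauss a (suc c) N + Z)) (shift-shift-≡ (suc (suc c)) a (suc (suc (a ℕ.+ c))) 0 _ exponents N) ⟩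
  (P + Q) + (gauss a (suc c) N + Z)
    ≡⟨ regroup P Q (gauss a (suc c) N) Z ⟩
  (P + (gauss a (suc c) N + Q)) + Z ∎
  where
  open ≡-Reasoning
  P = shift (suc (suc c)) (gaussPred a (suc (suc c))) N
  Q = shift (suc (suc (a ℕ.+ c))) (gauss a (suc c)) N
  Z = shift (suc a) (gauss (suc a) c) N
  exponents : suc (suc c) ℕ.+ a ≡ suc (suc (a ℕ.+ c)) ℕ.+ 0
  exponents = ℕ-Solver.solve (a ∷ c ∷ [])
  regroup : ∀ p q g z → (p + q) + (g + z) ≡ (p + (g + q)) + z
  regroup = solve-∀

Σ≤ : ℕ → (ℕ → Series) → Series
Σ≤ n F N = sumTo n (λ j → F j N)

-- Σ_k F k, meaningful when F k has order at least k: then only the k ≤ N contribute to [q^N].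
Σ∞ : (ℕ → Series) → Series
Σ∞ F N = sumTo N (λ k → F k N)

OrderAtLeastIndex : (ℕ → Series) → Set
OrderAtLeastIndex F = ∀ k N → N ℕ.< k → F k N ≡ 0ℤ

Σ≤-cong≤ : ∀ n {F G : ℕ → Series} → (∀ j → j ℕ.≤ n → F j ≗ G j) → Σ≤ n F ≗ Σ≤ n G
Σ≤-cong≤ n F≗G N = sumTo-cong≤ n (λ j j≤n → F≗G j j≤n N)

Σ≤-⊕ : ∀ n (F G : ℕ → Series) → Σ≤ n (λ j → F j ⊕ G j) ≗ Σ≤ n F ⊕ Σ≤ n G
Σ≤-⊕ n F G N = sumTo-+ n (λ j → F j N) (λ j → G j N)

Σ≤-shift : ∀ k n (F : ℕ → Series) → Σ≤ n (λ j → shift k (F j)) ≗ shift k (Σ≤ n F)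
Σ≤-shift k zero    F N = refl
Σ≤-shift k (suc n) F N =
  trans (cong (_+ shift k (F (suc n)) N) (Σ≤-shift k n F N)) (sym (shift-⊕ k (Σ≤ n F) (F (suc n)) N))

⊛-Σ≤ : ∀ f n (F : ℕ → Series) → f ⊛ Σ≤ n F ≗ Σ≤ n (λ j → f ⊛ F j)
⊛-Σ≤ f n F N = trans (sumTo-cong N (λ i → sym (sumTo-*ˡ n (f i) (λ j → F j (N ∸ i)))))
                     (sumTo-exchange N n (λ i j → f i * F j (N ∸ i)))

Σ∞-truncate : ∀ F → OrderAtLeastIndex F → ∀ M N → N ℕ.≤ M → Σ∞ F N ≡ Σ≤ M F N
Σ∞-truncate F ord M N N≤M = sym (sumTo-extend (λ k → F k N) N≤M (λ k N<k → ord k N N<k))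

⊛-Σ∞ : ∀ f F → OrderAtLeastIndex F → f ⊛ Σ∞ F ≗ Σ∞ (λ k → f ⊛ F k)
⊛-Σ∞ f F ord N = trans (⊛-cong≤ʳ N f (λ t t≤N → Σ∞-truncate F ord N t t≤N)) (⊛-Σ≤ f N F N)

shift-Σ∞ : ∀ k F → OrderAtLeastIndex F → ∀ M N → N ℕ.≤ M ℕ.+ k →
           shift k (Σ∞ F) N ≡ Σ≤ M (λ i → shift k (F i)) N
shift-Σ∞ k F ord M N N≤M+k =
  trans (shift-cong≤ k N (λ t t+k≤N → Σ∞-truncate F ord M t (ℕₚ.+-cancelʳ-≤ k t M (ℕₚ.≤-trans t+k≤N N≤M+k))))
        (sym (Σ≤-shift k M F N))

-- The series G_c and its product with J₁

gTerm : ℕ → ℕ → Series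
gTerm c n = shift n (gauss n (n ℕ.+ c))

G : ℕ → Series
G c = Σ∞ (gTerm c)

gTerm-order : ∀ c → OrderAtLeastIndex (gTerm c)
gTerm-order c n N N<n = shift-below n (gauss n (n ℕ.+ c)) N N<n

gPartial : ℕ → ℕ → Series
gPartial c zero    = 0S
gPartial c (suc K) = gPartial c K ⊕ gTerm c K

G-truncate : ∀ c K t → t ℕ.< K → G c t ≡ gPartial c K t
G-truncate c (suc K) t (s≤s t≤K) = trans (Σ∞-truncate (gTerm c) (gTerm-order c) K t t≤K) (sym (partial K t))
  where
  partial : ∀ K → gPartial c (suc K) ≗ Σ≤ K (gTerm c)
  partial zero    N = ℤₚ.+-identityˡ _
  partial (suc K) N = cong (_+ gTerm c (suc K) N) (partial K N)

gPartial-recurrence : ∀ c K →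
  gPartial c (2 ℕ.+ K) ⊕ shift (3 ℕ.+ c) (gPartial (3 ℕ.+ c) K) ≗ gauss (suc K) (2 ℕ.+ K ℕ.+ c)
gPartial-recurrence c zero    N = trans (cong₂ _+_ (cong (_+ shift 1 (gauss 1 (suc c)) N) (ℤₚ.+-identityˡ (1S N)))
                                                   (shift-0S (3 ℕ.+ c) N))
                                        (ℤₚ.+-identityʳ _)
gPartial-recurrence c (suc K) N = begin
  (gPartial c (2 ℕ.+ K) N + g) + shift c′ (gPartial c′ K ⊕ gTerm c′ K) N
    ≡⟨ cong (λ x → (gPartial c (2 ℕ.+ K) N + g) + x) (shift-⊕ c′ (gPartial c′ K) (gTerm c′ K) N) ⟩
  (gPartial c (2 ℕ.+ K) N + g) + (shift c′ (gPartial c′ K) N + shift c′ (gTerm c′ K) N)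
    ≡⟨ +-interchange (gPartial c (2 ℕ.+ K) N) g _ _ ⟩
  (gPartial c (2 ℕ.+ K) N + shift c′ (gPartial c′ K) N) + (g + shift c′ (gTerm c′ K) N)
    ≡⟨ cong₂ (λ u v → u + (g + v)) (gPartial-recurrence c K N) lastTerm ⟩
  gauss (suc K) (2 ℕ.+ K ℕ.+ c) N + (g + Z)
    ≡⟨ regroup (gauss (suc K) (2 ℕ.+ K ℕ.+ c) N) g Z ⟩
  (Z + gauss (suc K) (2 ℕ.+ K ℕ.+ c) N) + g
    ≡⟨ cong (_+ g) (sym (gauss-pascal′ K (2 ℕ.+ K ℕ.+ c) N)) ⟩
  gauss (2 ℕ.+ K) (3 ℕ.+ K ℕ.+ c) N ∎
  where
  open ≡-Reasoning
  c′ = 3 ℕ.+ c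
  g  = gTerm c (2 ℕ.+ K) N
  Z  = shift (3 ℕ.+ K ℕ.+ c) (gauss K (3 ℕ.+ K ℕ.+ c)) N
  exponent : ∀ c K → (3 ℕ.+ c) ℕ.+ K ≡ (3 ℕ.+ K ℕ.+ c) ℕ.+ 0
  exponent = ℕ-Solver.solve-∀
  width : ∀ c K → K ℕ.+ (3 ℕ.+ c) ≡ 3 ℕ.+ K ℕ.+ c
  width = ℕ-Solver.solve-∀
  lastTerm : shift c′ (gTerm c′ K) N ≡ Z
  lastTerm = trans (shift-shift-≡ c′ K (3 ℕ.+ K ℕ.+ c) 0 (gauss K (K ℕ.+ c′)) (exponent c K) N)
                   (shift-cong (3 ℕ.+ K ℕ.+ c) (gauss-≡ {K} refl (width c K)) N)
  regroup : ∀ b g z → b + (g + z) ≡ (z + b) + g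
  regroup = solve-∀

J₁-⊛-G-recurrence : ∀ c N → (J₁ ⊛ G c) N + shift (3 ℕ.+ c) (J₁ ⊛ G (3 ℕ.+ c)) N ≡ 1S N
J₁-⊛-G-recurrence c N = begin
  (J₁ ⊛ G c) N + shift c′ (J₁ ⊛ G c′) N
    ≡⟨ cong₂ _+_ (⊛-cong≤ʳ N J₁ (λ t t≤N → G-truncate c (2 ℕ.+ N) t (s≤s (ℕₚ.m≤n⇒m≤1+n t≤N))))
                 (trans (sym (⊛-shift c′ J₁ (G c′) N))
                        (⊛-cong≤ʳ N J₁ (λ t t≤N → shift-cong≤ c′ t (truncate t t≤N)))) ⟩
  (J₁ ⊛ gPartial c (2 ℕ.+ N)) N + (J₁ ⊛ shift c′ (gPartial c′ N)) N
    ≡⟨ sym (⊛-distribˡ-⊕ J₁ (gPartial c (2 ℕ.+ N)) (shift c′ (gPartial c′ N)) N) ⟩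
  (J₁ ⊛ (gPartial c (2 ℕ.+ N) ⊕ shift c′ (gPartial c′ N))) N
    ≡⟨ ⊛-cong (≗-refl {J₁}) (gPartial-recurrence c N) N ⟩
  (J₁ ⊛ gauss (suc N) (2 ℕ.+ N ℕ.+ c)) N
    ≡⟨ J₁-⊛-gauss (suc N) (2 ℕ.+ N ℕ.+ c) N (ℕₚ.n≤1+n N) (ℕₚ.≤-trans (ℕₚ.m≤m+n N c) (ℕₚ.m≤n+m _ 2)) ⟩
  1S N ∎
  where
  open ≡-Reasoning
  c′ = 3 ℕ.+ c
  truncate : ∀ t → t ℕ.≤ N → ∀ t′ → t′ ℕ.+ c′ ℕ.≤ t → G c′ t′ ≡ gPartial c′ N t′
  truncate t t≤N t′ t′+c′≤t =
    G-truncate c′ N t′ (ℕₚ.<-≤-trans (ℕₚ.m<m+n t′ {c′} (s≤s z≤n)) (ℕₚ.≤-trans t′+c′≤t t≤N))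

-- Partial theta series

triangle : ℕ → ℕ
triangle zero    = 0
triangle (suc j) = suc j ℕ.+ triangle j

triangle-≥ : ∀ i → i ℕ.≤ triangle i
triangle-≥ zero    = z≤n
triangle-≥ (suc i) = ℕₚ.m≤m+n (suc i) (triangle i)

sgn-suc : ∀ i → sgn (suc i) ≡ - sgn i
sgn-suc zero          = refl
sgn-suc (suc zero)    = refl
sgn-suc (suc (suc i)) = sgn-suc i

thetaExp : ℕ → ℕ → ℕ
thetaExp c i = i ℕ.* c ℕ.+ 3 ℕ.* triangle i

thetaTerm : ℕ → ℕ → Series
thetaTerm c i = mono (sgn i) (thetaExp c i)

theta : ℕ → Series
theta c = Σ∞ (thetaTerm c)

thetaExp-≥ : ∀ c i → i ℕ.≤ thetaExp c i
thetaExp-≥ c i = ℕₚ.≤-trans (triangle-≥ i)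
                   (ℕₚ.≤-trans (ℕₚ.m≤m+n (triangle i) _) (ℕₚ.m≤n+m (3 ℕ.* triangle i) (i ℕ.* c)))

thetaTerm-order : ∀ c → OrderAtLeastIndex (thetaTerm c)
thetaTerm-order c i N N<i = mono-below (sgn i) (thetaExp c i) N (ℕₚ.<-≤-trans N<i (thetaExp-≥ c i))

thetaTerm-suc : ∀ c i → thetaTerm c (suc i) ≗ neg (shift (3 ℕ.+ c) (thetaTerm (3 ℕ.+ c) i))
thetaTerm-suc c i N = begin
  mono (sgn (suc i)) (thetaExp c (suc i)) N            ≡⟨ cong (λ s → mono s (thetaExp c (suc i)) N) (sgn-suc i) ⟩
  mono (- sgn i) (thetaExp c (suc i)) N                ≡⟨ mono-neg (sgn i) (thetaExp c (suc i)) N ⟩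
  - mono (sgn i) (thetaExp c (suc i)) N                ≡⟨ cong (λ e → - mono (sgn i) e N) (exponent c i (triangle i)) ⟩
  - mono (sgn i) ((3 ℕ.+ c) ℕ.+ thetaExp (3 ℕ.+ c) i) N ≡⟨ cong -_ (mono-shift (sgn i) (3 ℕ.+ c) (thetaExp (3 ℕ.+ c) i) N) ⟩
  - shift (3 ℕ.+ c) (thetaTerm (3 ℕ.+ c) i) N          ∎
  where
  open ≡-Reasoning
  exponent : ∀ c i t → suc i ℕ.* c ℕ.+ 3 ℕ.* (suc i ℕ.+ t) ≡ (3 ℕ.+ c) ℕ.+ (i ℕ.* (3 ℕ.+ c) ℕ.+ 3 ℕ.* t)
  exponent = ℕ-Solver.solve-∀

theta-recurrence : ∀ c N → theta c N + shift (3 ℕ.+ c) (theta (3 ℕ.+ c)) N ≡ 1S N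
theta-recurrence c zero    = refl
theta-recurrence c (suc N) = begin
  theta c (suc N) + shift c′ (theta c′) (suc N)
    ≡⟨ cong₂ _+_ (sumTo-head N (λ i → thetaTerm c i (suc N)))
                 (shift-Σ∞ c′ (thetaTerm c′) (thetaTerm-order c′) N (suc N) (ℕₚ.m<m+n N (s≤s z≤n))) ⟩
  (thetaTerm c 0 (suc N) + sumTo N (λ i → thetaTerm c (suc i) (suc N))) + S
    ≡⟨ cong (λ x → (0ℤ + x) + S) (trans (sumTo-cong N (λ i → thetaTerm-suc c i (suc N))) (sumTo-neg N _)) ⟩
  (0ℤ + - S) + S
    ≡⟨ cancel S ⟩
  0ℤ ∎
  where
  open ≡-Reasoning
  c′ = 3 ℕ.+ c
  S  = Σ≤ N (λ i → shift c′ (thetaTerm c′ i)) (suc N)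
  cancel : ∀ s → (0ℤ + - s) + s ≡ 0ℤ
  cancel = solve-∀

-- The shift has positive order, so the recurrence fixes [q^N] f c in terms of lower coefficients.
recurrence-unique : ∀ d (f g : ℕ → Series) →
  (∀ c N → f c N + shift (suc d ℕ.+ c) (f (suc d ℕ.+ c)) N ≡ g c N + shift (suc d ℕ.+ c) (g (suc d ℕ.+ c)) N) →
  ∀ c → f c ≗ g c
recurrence-unique d f g recurrence c N = below (suc N) N ℕₚ.≤-refl c
  where
  below : ∀ B N → N ℕ.< B → ∀ c → f c N ≡ g c N
  below (suc B) N (s≤s N≤B) c = +-cancelʳ (shift c′ (f c′) N) (f c N) (g c N)
    (trans (recurrence c N) (cong (_+_ (g c N)) (sym (shift-cong≤ c′ N (λ t t+c′≤N → below B t (lower t+c′≤N) c′)))))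
    where
    c′ = suc d ℕ.+ c
    lower : ∀ {t} → t ℕ.+ c′ ℕ.≤ N → t ℕ.< B
    lower {t} t+c′≤N = ℕₚ.<-≤-trans (ℕₚ.m<m+n t {c′} (s≤s z≤n)) (ℕₚ.≤-trans t+c′≤N N≤B)

J₁-⊛-G : ∀ c → J₁ ⊛ G c ≗ theta c
J₁-⊛-G = recurrence-unique 2 (λ c → J₁ ⊛ G c) theta
  (λ c N → trans (J₁-⊛-G-recurrence c N) (sym (theta-recurrence c N)))

-- The square of (-q;q)_n

sqTerm : ℕ → ℕ → Series
sqTerm n j = shift (triangle j) (gauss (n ∸ j) (suc (n ℕ.+ j)))

-- sqTerm n j for j ≤ n, and 0 (rather than the junk value of n ∸ j) for j > n.
sqTerm₀ : ℕ → ℕ → Series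
sqTerm₀ n j = shift (triangle j) (gaussPred (suc n ∸ j) (suc (n ℕ.+ j)))

sqSum : ℕ → Series
sqSum n = Σ≤ n (sqTerm n)

-- For j = 0, j ∸ 1 = 0: the summands j = 0 and j = 1 of sqLeft n both equal q^(n+1) sqTerm n 0.
sqMiddle sqLeft sqRight : ℕ → ℕ → Series
sqMiddle n j = sqTerm₀ n j ⊕ shift (suc n ℕ.+ suc n) (sqTerm₀ n j)
sqLeft   n j = shift (suc n) (sqTerm n (j ∸ 1))
sqRight  n j = shift (suc n) (sqTerm₀ n (suc j))

sqTerm₀-≤ : ∀ n j → j ℕ.≤ n → sqTerm₀ n j ≗ sqTerm n j
sqTerm₀-≤ n j j≤n = shift-cong (triangle j) (gaussPred-≡ {b = suc (n ℕ.+ j)} (ℕₚ.+-∸-assoc 1 j≤n) refl)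

sqTerm₀-> : ∀ n j → n ℕ.< j → sqTerm₀ n j ≗ 0S
sqTerm₀-> n j n<j = ≗-trans (shift-cong (triangle j) (gaussPred-≡ {b = suc (n ℕ.+ j)} (ℕₚ.m≤n⇒m∸n≡0 n<j) refl))
                           (shift-0S (triangle j))

sqTerm-suc-left : ∀ n j → j ℕ.≤ n →
  shift (triangle j) (shift (suc (n ∸ j)) (gauss (suc (n ∸ j)) (n ℕ.+ j))) ≗ sqLeft n j
sqTerm-suc-left n zero    _   = shift-cong (suc n) (≗-trans (gauss-sym (suc n) (n ℕ.+ 0))
                                  (gauss-≡ (ℕₚ.+-identityʳ n) (cong suc (sym (ℕₚ.+-identityʳ n)))))
sqTerm-suc-left n (suc j) j<n = ≗-trans
  (shift-shift-≡ (triangle (suc j)) (suc a) (suc n) (triangle j) _ (exponent a j (triangle j) (ℕₚ.m∸n+n≡m j<n)))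
  (shift-cong (suc n) (shift-cong (triangle j) (gauss-≡ (sym (ℕₚ.+-∸-assoc 1 j<n)) (ℕₚ.+-suc n j))))
  where
  a = n ∸ suc j
  exponent : ∀ a j t {n} → a ℕ.+ suc j ≡ n → (suc j ℕ.+ t) ℕ.+ suc a ≡ suc n ℕ.+ t
  exponent a j t refl = ℕ-Solver.solve (a ∷ j ∷ t ∷ [])

sqTerm-suc-≤ : ∀ n j → j ℕ.≤ n → sqTerm (suc n) j ≗ (sqMiddle n j ⊕ sqLeft n j) ⊕ sqRight n j
sqTerm-suc-≤ n j j≤n N = begin
  shift t (gauss (suc n ∸ j) (suc (suc (n ℕ.+ j)))) N
    ≡⟨ shift-cong t (≗-trans (gauss-≡ (ℕₚ.+-∸-assoc 1 j≤n) refl) (gauss-split a c)) N ⟩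
  shift t ((p₁ ⊕ (p₂ ⊕ p₃)) ⊕ p₄) N
    ≡⟨ trans (shift-⊕ t (p₁ ⊕ (p₂ ⊕ p₃)) p₄ N)
             (cong (_+ shift t p₄ N) (trans (shift-⊕ t p₁ (p₂ ⊕ p₃) N)
                                            (cong (_+_ (shift t p₁ N)) (shift-⊕ t p₂ p₃ N)))) ⟩
  (shift t p₁ N + (shift t p₂ N + shift t p₃ N)) + shift t p₄ N
    ≡⟨ cong₂ _+_ (cong₂ _+_ right (cong₂ _+_ middle middle′)) (sqTerm-suc-left n j j≤n N) ⟩
  (sqRight n j N + (sqTerm₀ n j N + shift (suc n ℕ.+ suc n) (sqTerm₀ n j) N)) + sqLeft n j N
    ≡⟨ regroup (sqRight n j N) (sqTerm₀ n j N) _ (sqLeft n j N) ⟩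
  ((sqTerm₀ n j N + shift (suc n ℕ.+ suc n) (sqTerm₀ n j) N) + sqLeft n j N) + sqRight n j N ∎
  where
  open ≡-Reasoning
  t = triangle j
  a = n ∸ j
  c = n ℕ.+ j
  p₁ = shift (suc (suc c)) (gaussPred a (suc (suc c)))
  p₂ = gauss a (suc c)
  p₃ = shift (suc (suc (a ℕ.+ c))) (gauss a (suc c))
  p₄ = shift (suc a) (gauss (suc a) c)
  regroup : ∀ r x y l → (r + (x + y)) + l ≡ ((x + y) + l) + r
  regroup = solve-∀
  exponent₁ : ∀ n j t → t ℕ.+ suc (suc (n ℕ.+ j)) ≡ suc n ℕ.+ (suc j ℕ.+ t)
  exponent₁ = ℕ-Solver.solve-∀
  exponent₃ : ∀ a j t {n} → a ℕ.+ j ≡ n → t ℕ.+ suc (suc (a ℕ.+ (n ℕ.+ j))) ≡ (suc n ℕ.+ suc n) ℕ.+ t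
  exponent₃ a j t refl = ℕ-Solver.solve (a ∷ j ∷ t ∷ [])
  right : shift t p₁ N ≡ sqRight n j N
  right = trans (shift-shift-≡ t (suc (suc c)) (suc n) (triangle (suc j)) _ (exponent₁ n j t) N)
                (shift-cong (suc n) (shift-cong (triangle (suc j)) (gaussPred-≡ {a} refl (cong suc (sym (ℕₚ.+-suc n j))))) N)
  middle : shift t p₂ N ≡ sqTerm₀ n j N
  middle = sym (sqTerm₀-≤ n j j≤n N)
  middle′ : shift t p₃ N ≡ shift (suc n ℕ.+ suc n) (sqTerm₀ n j) N
  middle′ = trans (shift-shift-≡ t _ (suc n ℕ.+ suc n) t p₂ (exponent₃ a j t (ℕₚ.m∸n+n≡m j≤n)) N)
                  (shift-cong (suc n ℕ.+ suc n) (≗-sym (sqTerm₀-≤ n j j≤n)) N)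

sqTerm-suc-top : ∀ n → sqTerm (suc n) (suc n) ≗ (sqMiddle n (suc n) ⊕ sqLeft n (suc n)) ⊕ sqRight n (suc n)
sqTerm-suc-top n N = begin
  sqTerm (suc n) (suc n) N
    ≡⟨ trans (shift-cong (triangle (suc n)) (gauss-≡ {b = suc (suc n ℕ.+ suc n)} (ℕₚ.n∸n≡0 n) refl) N)
             (sym (shift-shift (suc n) (triangle n) 1S N)) ⟩
  shift (suc n) (shift (triangle n) 1S) N
    ≡⟨ pad (shift (suc n) (shift (triangle n) 1S) N) ⟩
  ((0ℤ + 0ℤ) + shift (suc n) (shift (triangle n) 1S) N) + 0ℤ
    ≡⟨ cong₂ _+_ (cong₂ _+_ (sym middle) (sym (shift-cong (suc n) top N))) (sym right) ⟩
  ((sqMiddle n (suc n) ⊕ sqLeft n (suc n)) ⊕ sqRight n (suc n)) N ∎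
  where
  open ≡-Reasoning
  pad : ∀ x → x ≡ ((0ℤ + 0ℤ) + x) + 0ℤ
  pad = solve-∀
  vanishes : ∀ j → n ℕ.< j → sqTerm₀ n j ≗ 0S
  vanishes = sqTerm₀-> n
  middle : sqMiddle n (suc n) N ≡ 0ℤ + 0ℤ
  middle = cong₂ _+_ (vanishes (suc n) ℕₚ.≤-refl N)
                     (trans (shift-cong (suc n ℕ.+ suc n) (vanishes (suc n) ℕₚ.≤-refl) N) (shift-0S (suc n ℕ.+ suc n) N))
  right : sqRight n (suc n) N ≡ 0ℤ
  right = trans (shift-cong (suc n) (vanishes (suc (suc n)) (ℕₚ.n≤1+n (suc n))) N) (shift-0S (suc n) N)
  top : sqTerm n n ≗ shift (triangle n) 1S
  top = shift-cong (triangle n) (gauss-≡ {b = suc (n ℕ.+ n)} (ℕₚ.n∸n≡0 n) refl)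

sqTerm-suc : ∀ n j → j ℕ.≤ suc n → sqTerm (suc n) j ≗ (sqMiddle n j ⊕ sqLeft n j) ⊕ sqRight n j
sqTerm-suc n j j≤1+n with ℕₚ.m≤n⇒m<n∨m≡n j≤1+n
... | inj₁ (s≤s j≤n) = sqTerm-suc-≤ n j j≤n
... | inj₂ refl      = sqTerm-suc-top n

Σ≤-sqTerm₀ : ∀ n → Σ≤ (suc n) (sqTerm₀ n) ≗ sqSum n
Σ≤-sqTerm₀ n N = trans (cong₂ _+_ (Σ≤-cong≤ n (sqTerm₀-≤ n) N) (sqTerm₀-> n (suc n) ℕₚ.≤-refl N))
                       (ℤₚ.+-identityʳ _)

Σ≤-sqMiddle : ∀ n → Σ≤ (suc n) (sqMiddle n) ≗ sqSum n ⊕ shift (suc n ℕ.+ suc n) (sqSum n)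
Σ≤-sqMiddle n = ≗-trans (Σ≤-⊕ (suc n) (sqTerm₀ n) (λ j → shift (suc n ℕ.+ suc n) (sqTerm₀ n j)))
  (⊕-cong (Σ≤-sqTerm₀ n)
          (≗-trans (Σ≤-shift (suc n ℕ.+ suc n) (suc n) (sqTerm₀ n)) (shift-cong (suc n ℕ.+ suc n) (Σ≤-sqTerm₀ n))))

Σ≤-sqLeft : ∀ n → Σ≤ (suc n) (sqLeft n) ≗ shift (suc n) (sqTerm n 0 ⊕ sqSum n)
Σ≤-sqLeft n = ≗-trans (Σ≤-shift (suc n) (suc n) (λ j → sqTerm n (j ∸ 1)))
                      (shift-cong (suc n) (λ N → sumTo-head n (λ j → sqTerm n (j ∸ 1) N)))

Σ≤-sqRight : ∀ n → Σ≤ (suc n) (sqRight n) ≗ shift (suc n) (sqSum n ⊖ sqTerm n 0)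
Σ≤-sqRight n = ≗-trans (Σ≤-shift (suc n) (suc n) (λ j → sqTerm₀ n (suc j))) (shift-cong (suc n) dropHead)
  where
  dropHead : Σ≤ (suc n) (λ j → sqTerm₀ n (suc j)) ≗ sqSum n ⊖ sqTerm n 0
  dropHead N = begin
    Σ≤ (suc n) (λ j → sqTerm₀ n (suc j)) N
      ≡⟨ addSubtract _ (sqTerm₀ n 0 N) ⟩
    (sqTerm₀ n 0 N + Σ≤ (suc n) (λ j → sqTerm₀ n (suc j)) N) + - sqTerm₀ n 0 N
      ≡⟨ cong₂ (λ u v → u + - v) (sym (sumTo-head (suc n) (λ j → sqTerm₀ n j N))) (sqTerm₀-≤ n 0 z≤n N) ⟩
    Σ≤ (suc (suc n)) (sqTerm₀ n) N + - sqTerm n 0 N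
      ≡⟨ cong (λ u → u + - sqTerm n 0 N)
              (trans (cong₂ _+_ (Σ≤-sqTerm₀ n N) (sqTerm₀-> n (suc (suc n)) (ℕₚ.n≤1+n (suc n)) N))
                     (ℤₚ.+-identityʳ (sqSum n N))) ⟩
    sqSum n N + - sqTerm n 0 N ∎
    where
    open ≡-Reasoning
    addSubtract : ∀ x y → x ≡ (y + x) + - y
    addSubtract = solve-∀

sqSum-suc : ∀ n → sqSum (suc n) ≗
  ((sqSum n ⊕ shift (suc n) (sqSum n)) ⊕ shift (suc n) (sqSum n)) ⊕ shift (suc n ℕ.+ suc n) (sqSum n)
sqSum-suc n N = begin
  sqSum (suc n) N
    ≡⟨ Σ≤-cong≤ (suc n) (sqTerm-suc n) N ⟩
  Σ≤ (suc n) (λ j → (sqMiddle n j ⊕ sqLeft n j) ⊕ sqRight n j) N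
    ≡⟨ trans (Σ≤-⊕ (suc n) (λ j → sqMiddle n j ⊕ sqLeft n j) (sqRight n) N)
             (cong (_+ Σ≤ (suc n) (sqRight n) N) (Σ≤-⊕ (suc n) (sqMiddle n) (sqLeft n) N)) ⟩
  (Σ≤ (suc n) (sqMiddle n) N + Σ≤ (suc n) (sqLeft n) N) + Σ≤ (suc n) (sqRight n) N
    ≡⟨ cong₂ _+_ (cong₂ _+_ (Σ≤-sqMiddle n N) (trans (Σ≤-sqLeft n N) (shift-⊕ (suc n) (sqTerm n 0) (sqSum n) N)))
                 (trans (Σ≤-sqRight n N) (trans (shift-⊕ (suc n) (sqSum n) (neg (sqTerm n 0)) N)
                                                (cong (_+_ S₁) (shift-neg (suc n) (sqTerm n 0) N)))) ⟩
  ((sqSum n N + S₂) + (S₀ + S₁)) + (S₁ + - S₀)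
    ≡⟨ collect (sqSum n N) S₂ S₀ S₁ ⟩
  ((sqSum n N + S₁) + S₁) + S₂ ∎
  where
  open ≡-Reasoning
  S₀ = shift (suc n) (sqTerm n 0) N
  S₁ = shift (suc n) (sqSum n) N
  S₂ = shift (suc n ℕ.+ suc n) (sqSum n) N
  collect : ∀ d s₂ s₀ s₁ → ((d + s₂) + (s₀ + s₁)) + (s₁ + - s₀) ≡ ((d + s₁) + s₁) + s₂
  collect = solve-∀

⊛-interchange : ∀ f g → (f ⊛ g) ⊛ (f ⊛ g) ≗ ((f ⊛ f) ⊛ g) ⊛ g
⊛-interchange f g = begin
  (f ⊛ g) ⊛ (f ⊛ g)      ≈⟨ ⊛-assoc f g (f ⊛ g) ⟩
  f ⊛ (g ⊛ (f ⊛ g))      ≈⟨ ⊛-cong (≗-refl {f}) (≗-sym (⊛-assoc g f g)) ⟩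
  f ⊛ ((g ⊛ f) ⊛ g)      ≈⟨ ⊛-cong (≗-refl {f}) (⊛-cong (⊛-comm g f) (≗-refl {g})) ⟩
  f ⊛ ((f ⊛ g) ⊛ g)      ≈⟨ ⊛-cong (≗-refl {f}) (⊛-assoc f g g) ⟩
  f ⊛ (f ⊛ (g ⊛ g))      ≈⟨ ≗-sym (⊛-assoc f f (g ⊛ g)) ⟩
  (f ⊛ f) ⊛ (g ⊛ g)      ≈⟨ ≗-sym (⊛-assoc (f ⊛ f) g g) ⟩
  ((f ⊛ f) ⊛ g) ⊛ g      ∎
  where open ≗-Reasoning

⊛-binomial-twice : ∀ f k → (f ⊛ (1S ⊕ mono 1ℤ k)) ⊛ (1S ⊕ mono 1ℤ k) ≗
                             ((f ⊕ shift k f) ⊕ shift k f) ⊕ shift (k ℕ.+ k) f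
⊛-binomial-twice f k N = begin
  ((f ⊛ F) ⊛ F) N
    ≡⟨ ⊛-binomial (f ⊛ F) 1ℤ k N ⟩
  (f ⊛ F) N + 1ℤ * shift k (f ⊛ F) N
    ≡⟨ cong₂ (λ u v → u + 1ℤ * v) (⊛-binomial f 1ℤ k N) (shift-cong k (⊛-binomial f 1ℤ k) N) ⟩
  (f N + 1ℤ * shift k f N) + 1ℤ * shift k (f ⊕ 1ℤ · shift k f) N
    ≡⟨ cong (λ v → (f N + 1ℤ * shift k f N) + 1ℤ * v)
            (trans (shift-⊕ k f (1ℤ · shift k f) N) (cong (_+_ (shift k f N)) (trans (shift-· k 1ℤ (shift k f) N)
                                                                                       (cong (1ℤ *_) (shift-shift k k f N))))) ⟩
  (f N + 1ℤ * shift k f N) + 1ℤ * (shift k f N + 1ℤ * shift (k ℕ.+ k) f N)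
    ≡⟨ simplify (f N) (shift k f N) (shift (k ℕ.+ k) f N) ⟩
  ((f N + shift k f N) + shift k f N) + shift (k ℕ.+ k) f N ∎
  where
  open ≡-Reasoning
  F = 1S ⊕ mono 1ℤ k
  simplify : ∀ x y z → (x + 1ℤ * y) + 1ℤ * (y + 1ℤ * z) ≡ ((x + y) + y) + z
  simplify = solve-∀

poch-square : ∀ n → poch -1ℤ 1 n ⊛ poch -1ℤ 1 n ≗ sqSum n
poch-square zero    = ⊛-identityˡ 1S
poch-square (suc n) = begin
  (P ⊛ F) ⊛ (P ⊛ F)                                         ≈⟨ ⊛-interchange P F ⟩
  ((P ⊛ P) ⊛ F) ⊛ F                                         ≈⟨ ⊛-binomial-twice (P ⊛ P) (suc n) ⟩
  (((P ⊛ P) ⊕ shift (suc n) (P ⊛ P)) ⊕ shift (suc n) (P ⊛ P)) ⊕ shift (suc n ℕ.+ suc n) (P ⊛ P)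
    ≈⟨ ⊕-cong (⊕-cong (⊕-cong IH (shift-cong (suc n) IH)) (shift-cong (suc n) IH)) (shift-cong (suc n ℕ.+ suc n) IH) ⟩
  ((sqSum n ⊕ shift (suc n) (sqSum n)) ⊕ shift (suc n) (sqSum n)) ⊕ shift (suc n ℕ.+ suc n) (sqSum n)
    ≈⟨ ≗-sym (sqSum-suc n) ⟩
  sqSum (suc n)                                             ∎
  where
  open ≗-Reasoning
  P  = poch -1ℤ 1 n
  F  = 1S ⊕ mono 1ℤ (suc n)
  IH = poch-square n

-- U as a sum of shifted G's

uTerm : ℕ → ℕ → Series
uTerm j n = shift (triangle (suc j)) (gTerm (suc (j ℕ.+ j)) n)

shift-sqTerm : ∀ k j → j ℕ.≤ k → shift (suc k) (sqTerm k j) ≗ uTerm j (k ∸ j)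
shift-sqTerm k j j≤k = ≗-trans
  (shift-shift-≡ (suc k) (triangle j) (triangle (suc j)) n _ (exponent j n (triangle j) n+j≡k))
  (shift-cong (triangle (suc j)) (shift-cong n (gauss-≡ {n} refl (width j n n+j≡k))))
  where
  n = k ∸ j
  n+j≡k : n ℕ.+ j ≡ k
  n+j≡k = ℕₚ.m∸n+n≡m j≤k
  exponent : ∀ j n t {k} → n ℕ.+ j ≡ k → suc k ℕ.+ t ≡ (suc j ℕ.+ t) ℕ.+ n
  exponent j n t refl = ℕ-Solver.solve (j ∷ n ∷ t ∷ [])
  width : ∀ j n {k} → n ℕ.+ j ≡ k → suc (k ℕ.+ j) ≡ n ℕ.+ suc (j ℕ.+ j)
  width j n refl = ℕ-Solver.solve (j ∷ n ∷ [])

uTerm-vanish : ∀ N j n → N ∸ j ℕ.< n → uTerm j n N ≡ 0ℤ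
uTerm-vanish N j n N∸j<n = trans (shift-shift (triangle (suc j)) n _ N) (shift-below (triangle (suc j) ℕ.+ n) _ N N<exp)
  where
  N<exp : N ℕ.< triangle (suc j) ℕ.+ n
  N<exp = ℕₚ.<-≤-trans (ℕₚ.≤-<-trans (ℕₚ.m≤n+m∸n N j) (ℕₚ.+-monoʳ-< j N∸j<n))
                       (ℕₚ.+-monoˡ-≤ n (ℕₚ.≤-trans (ℕₚ.n≤1+n j) (triangle-≥ (suc j))))

uFamily : ℕ → Series
uFamily j = shift (triangle (suc j)) (G (suc (j ℕ.+ j)))

uFamily-order : OrderAtLeastIndex uFamily
uFamily-order j N N<j =
  shift-below (triangle (suc j)) _ N (ℕₚ.<-≤-trans N<j (ℕₚ.≤-trans (ℕₚ.n≤1+n j) (triangle-≥ (suc j))))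

U-as-Σ∞ : U ≗ Σ∞ uFamily
U-as-Σ∞ N = begin
  U N
    ≡⟨ sumTo-cong N (λ k → trans (⊛-mono (poch -1ℤ 1 k ⊛ poch -1ℤ 1 k) 1ℤ (suc k) N)
                                 (trans (ℤₚ.*-identityˡ _) (shift-cong (suc k) (poch-square k) N))) ⟩
  sumTo N (λ k → shift (suc k) (sqSum k) N)
    ≡⟨ sumTo-cong N (λ k → sym (Σ≤-shift (suc k) k (sqTerm k) N)) ⟩
  sumTo N (λ k → sumTo k (λ j → shift (suc k) (sqTerm k j) N))
    ≡⟨ sumTo-cong N (λ k → sumTo-cong≤ k (λ j j≤k → shift-sqTerm k j j≤k N)) ⟩
  sumTo N (λ k → sumTo k (λ j → uTerm j (k ∸ j) N))
    ≡⟨ sumTo-antidiagonal N (λ j n → uTerm j n N) ⟩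
  sumTo N (λ j → sumTo (N ∸ j) (λ n → uTerm j n N))
    ≡⟨ sumTo-cong N (λ j → sym (sumTo-extend _ (ℕₚ.m∸n≤m N j) (uTerm-vanish N j))) ⟩
  sumTo N (λ j → Σ≤ N (uTerm j) N)
    ≡⟨ sumTo-cong N (λ j → sym (shift-Σ∞ (triangle (suc j)) _ (gTerm-order (suc (j ℕ.+ j))) N N
                                          (ℕₚ.m≤m+n N (triangle (suc j))))) ⟩
  Σ∞ uFamily N ∎
  where open ≡-Reasoning

J₁-⊛-U : J₁ ⊛ U ≗ Σ∞ (λ j → shift (triangle (suc j)) (theta (suc (j ℕ.+ j))))
J₁-⊛-U = begin
  J₁ ⊛ U                 ≈⟨ ⊛-cong (≗-refl {J₁}) U-as-Σ∞ ⟩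
  J₁ ⊛ Σ∞ uFamily        ≈⟨ ⊛-Σ∞ J₁ uFamily uFamily-order ⟩
  Σ∞ (λ j → J₁ ⊛ uFamily j)
    ≈⟨ (λ N → sumTo-cong N (λ j → trans (⊛-shift (triangle (suc j)) J₁ _ N)
                                       (shift-cong (triangle (suc j)) (J₁-⊛-G (suc (j ℕ.+ j))) N))) ⟩
  Σ∞ (λ j → shift (triangle (suc j)) (theta (suc (j ℕ.+ j)))) ∎
  where open ≗-Reasoning

termExp : ℕ → ℕ → ℕ
termExp i j = triangle (suc j) ℕ.+ thetaExp (suc (j ℕ.+ j)) i

termExp-> : ∀ i j → j ℕ.+ i ℕ.< termExp i j
termExp-> i j = ℕₚ.+-mono-≤ (triangle-≥ (suc j)) (thetaExp-≥ (suc (j ℕ.+ j)) i)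

triangle-double : ∀ i → triangle i ℕ.+ triangle i ≡ i ℕ.* suc i
triangle-double zero    = refl
triangle-double (suc i) = trans (split i (triangle i)) (trans (cong (2 ℕ.* suc i ℕ.+_) (triangle-double i)) (close i))
  where
  split : ∀ i t → (suc i ℕ.+ t) ℕ.+ (suc i ℕ.+ t) ≡ 2 ℕ.* suc i ℕ.+ (t ℕ.+ t)
  split = ℕ-Solver.solve-∀
  close : ∀ i → 2 ℕ.* suc i ℕ.+ i ℕ.* suc i ≡ suc i ℕ.* suc (suc i)
  close = ℕ-Solver.solve-∀

triangle-even : ∀ m → triangle (m ℕ.+ m) ≡ m ℕ.* suc (m ℕ.+ m)
triangle-even m = ℕₚ.*-cancelˡ-≡ (triangle (m ℕ.+ m)) _ 2
  (trans (twice (triangle (m ℕ.+ m))) (trans (triangle-double (m ℕ.+ m)) (closed m)))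
  where
  twice : ∀ t → 2 ℕ.* t ≡ t ℕ.+ t
  twice = ℕ-Solver.solve-∀
  closed : ∀ m → (m ℕ.+ m) ℕ.* suc (m ℕ.+ m) ≡ 2 ℕ.* (m ℕ.* suc (m ℕ.+ m))
  closed = ℕ-Solver.solve-∀

triangle-half : ∀ i → (suc i ℕ.* (suc i ∸ 1)) / 2 ≡ triangle i
triangle-half i = trans (cong (_/ 2) (trans (ℕₚ.*-comm (suc i) i) (trans (sym (triangle-double i)) (double (triangle i)))))
                        (m*n/n≡m (triangle i) 2)
  where
  double : ∀ t → t ℕ.+ t ≡ t ℕ.* 2
  double = ℕ-Solver.solve-∀

-- The solver treats triangle numbers as atoms: collect them first, then substitute their closed forms.
square-split : ∀ i m →
  2 ℕ.* suc (i ℕ.+ m) ℕ.* suc (i ℕ.+ m) ≡ suc (i ℕ.+ m) ℕ.+ (triangle i ℕ.+ termExp i (m ℕ.+ m))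
square-split i m = sym (begin
  suc (i ℕ.+ m) ℕ.+ (triangle i ℕ.+ termExp i (m ℕ.+ m))
    ≡⟨ collect i m (triangle i) (triangle (m ℕ.+ m)) ⟩
  rest (triangle (m ℕ.+ m)) ℕ.+ 2 ℕ.* (triangle i ℕ.+ triangle i)
    ≡⟨ cong₂ (λ u d → rest u ℕ.+ 2 ℕ.* d) (triangle-even m) (triangle-double i) ⟩
  rest (m ℕ.* suc (m ℕ.+ m)) ℕ.+ 2 ℕ.* (i ℕ.* suc i)
    ≡⟨ closed i m ⟩
  2 ℕ.* suc (i ℕ.+ m) ℕ.* suc (i ℕ.+ m) ∎)
  where
  open ≡-Reasoning
  rest : ℕ → ℕ
  rest u = suc (i ℕ.+ m) ℕ.+ ((suc (m ℕ.+ m) ℕ.+ u) ℕ.+ i ℕ.* suc ((m ℕ.+ m) ℕ.+ (m ℕ.+ m)))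
  collect : ∀ i m t u →
    suc (i ℕ.+ m) ℕ.+ (t ℕ.+ ((suc (m ℕ.+ m) ℕ.+ u) ℕ.+ (i ℕ.* suc ((m ℕ.+ m) ℕ.+ (m ℕ.+ m)) ℕ.+ 3 ℕ.* t)))
      ≡ (suc (i ℕ.+ m) ℕ.+ ((suc (m ℕ.+ m) ℕ.+ u) ℕ.+ i ℕ.* suc ((m ℕ.+ m) ℕ.+ (m ℕ.+ m)))) ℕ.+ 2 ℕ.* (t ℕ.+ t)
  collect = ℕ-Solver.solve-∀
  closed : ∀ i m →
    (suc (i ℕ.+ m) ℕ.+ ((suc (m ℕ.+ m) ℕ.+ m ℕ.* suc (m ℕ.+ m)) ℕ.+ i ℕ.* suc ((m ℕ.+ m) ℕ.+ (m ℕ.+ m))))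
      ℕ.+ 2 ℕ.* (i ℕ.* suc i) ≡ 2 ℕ.* suc (i ℕ.+ m) ℕ.* suc (i ℕ.+ m)
  closed = ℕ-Solver.solve-∀

expo-even : ∀ i m → expo (suc (i ℕ.+ m)) (suc i) ≡ termExp i (m ℕ.+ m)
expo-even i m = begin
  (2 ℕ.* n ℕ.* n ∸ n) ∸ (suc i ℕ.* (suc i ∸ 1)) / 2
    ≡⟨ cong₂ _∸_ (trans (cong (_∸ n) (square-split i m)) (ℕₚ.m+n∸m≡n n _)) (triangle-half i) ⟩
  (triangle i ℕ.+ termExp i (m ℕ.+ m)) ∸ triangle i
    ≡⟨ ℕₚ.m+n∸m≡n (triangle i) _ ⟩
  termExp i (m ℕ.+ m) ∎
  where
  open ≡-Reasoning
  n = suc (i ℕ.+ m)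

expo-odd : ∀ i m → expo (suc (i ℕ.+ m)) (suc i) ℕ.+ 2 ℕ.* suc (i ℕ.+ m) ≡ termExp i (suc (m ℕ.+ m))
expo-odd i m = trans (cong (ℕ._+ 2 ℕ.* suc (i ℕ.+ m)) (expo-even i m)) (step i m (triangle i) (triangle (m ℕ.+ m)))
  where
  step : ∀ i m t u →
    ((suc (m ℕ.+ m) ℕ.+ u) ℕ.+ (i ℕ.* suc ((m ℕ.+ m) ℕ.+ (m ℕ.+ m)) ℕ.+ 3 ℕ.* t)) ℕ.+ 2 ℕ.* suc (i ℕ.+ m)
      ≡ (suc (suc (m ℕ.+ m)) ℕ.+ (suc (m ℕ.+ m) ℕ.+ u))
          ℕ.+ (i ℕ.* suc (suc (m ℕ.+ m) ℕ.+ suc (m ℕ.+ m)) ℕ.+ 3 ℕ.* t)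
  step = ℕ-Solver.solve-∀

-- Reindexing both sides as one double sum

term : ℕ → ℕ → Series
term i j = mono (sgn i) (termExp i j)

term-vanish : ∀ {M} i j → M ℕ.< j ℕ.+ i → term i j (suc M) ≡ 0ℤ
term-vanish i j M<j+i = mono-below (sgn i) (termExp i j) _ (ℕₚ.<-≤-trans (s≤s M<j+i) (termExp-> i j))

term-vanishʳ : ∀ {M} i j → M ℕ.< j → term i j (suc M) ≡ 0ℤ
term-vanishʳ i j M<j = term-vanish i j (ℕₚ.<-≤-trans M<j (ℕₚ.m≤m+n j i))

term-vanishˡ : ∀ {M} i j → M ℕ.< i → term i j (suc M) ≡ 0ℤ
term-vanishˡ i j M<i = term-vanish i j (ℕₚ.<-≤-trans M<i (ℕₚ.m≤n+m i j))

J₁-⊛-U-double-sum : ∀ N → (J₁ ⊛ U) N ≡ sumTo N (λ i → sumTo N (λ j → term i j N))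
J₁-⊛-U-double-sum N = begin
  (J₁ ⊛ U) N
    ≡⟨ J₁-⊛-U N ⟩
  sumTo N (λ j → shift (triangle (suc j)) (theta (suc (j ℕ.+ j))) N)
    ≡⟨ sumTo-cong N (λ j → shift-Σ∞ (triangle (suc j)) _ (thetaTerm-order (suc (j ℕ.+ j))) N N (ℕₚ.m≤m+n N _)) ⟩
  sumTo N (λ j → Σ≤ N (λ i → shift (triangle (suc j)) (thetaTerm (suc (j ℕ.+ j)) i)) N)
    ≡⟨ sumTo-cong N (λ j → sumTo-cong N (λ i → sym (mono-shift (sgn i) (triangle (suc j)) _ N))) ⟩
  sumTo N (λ j → sumTo N (λ i → term i j N))
    ≡⟨ sumTo-exchange N N (λ j i → term i j N) ⟩
  sumTo N (λ i → sumTo N (λ j → term i j N)) ∎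
  where open ≡-Reasoning

RHS-double-sum : ∀ M → RHS (suc M) ≡ sumTo M (λ i → sumTo M (λ j → term i j (suc M)))
RHS-double-sum M = begin
  RHS (suc M)
    ≡⟨ sum1To-suc M _ ⟩
  sumTo M (λ n → sum1To (suc n) (summand (suc n)))
    ≡⟨ sumTo-cong M (λ n → sum1To-suc n (summand (suc n))) ⟩
  sumTo M (λ n → sumTo n (λ r → summand (suc n) (suc r)))
    ≡⟨ sumTo-cong M (λ n → sumTo-cong≤ n (λ r r≤n → reindex n r r≤n)) ⟩
  sumTo M (λ n → sumTo n (λ r → pair r (n ∸ r)))
    ≡⟨ sumTo-antidiagonal M pair ⟩
  sumTo M (λ i → sumTo (M ∸ i) (pair i))
    ≡⟨ sumTo-cong M (λ i → sym (sumTo-extend (pair i) (ℕₚ.m∸n≤m M i) (pair-vanish i))) ⟩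
  sumTo M (λ i → sumTo M (pair i))
    ≡⟨ sumTo-cong M (λ i → sumTo-pairs M (λ j → term i j (suc M))) ⟩
  sumTo M (λ i → sumTo (suc (M ℕ.+ M)) (λ j → term i j (suc M)))
    ≡⟨ sumTo-cong M (λ i → sumTo-extend _ (ℕₚ.m≤n⇒m≤1+n (ℕₚ.m≤m+n M M)) (λ j M<j → term-vanishʳ i j M<j)) ⟩
  sumTo M (λ i → sumTo M (λ j → term i j (suc M))) ∎
  where
  open ≡-Reasoning
  summand : ℕ → ℕ → ℤ
  summand n r = (mono (sgn (r ∸ 1)) (expo n r) ⊕ mono (sgn (r ∸ 1)) (expo n r ℕ.+ 2 ℕ.* n)) (suc M)
  pair : ℕ → ℕ → ℤ
  pair i m = term i (m ℕ.+ m) (suc M) + term i (suc (m ℕ.+ m)) (suc M)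
  reindex : ∀ n r → r ℕ.≤ n → summand (suc n) (suc r) ≡ pair r (n ∸ r)
  reindex n r r≤n rewrite sym (ℕₚ.m+[n∸m]≡n r≤n) | ℕₚ.m+n∸m≡n r (n ∸ r) =
    cong₂ _+_ (cong (λ e → mono (sgn r) e (suc M)) (expo-even r (n ∸ r)))
              (cong (λ e → mono (sgn r) e (suc M)) (expo-odd r (n ∸ r)))
  pair-vanish : ∀ i m → M ∸ i ℕ.< m → pair i m ≡ 0ℤ
  pair-vanish i m M∸i<m = cong₂ _+_ (term-vanish i (m ℕ.+ m) (bound (ℕₚ.m≤m+n m m)))
                                      (term-vanish i (suc (m ℕ.+ m)) (bound (ℕₚ.m≤n⇒m≤1+n (ℕₚ.m≤m+n m m))))
    where
    bound : ∀ {j} → m ℕ.≤ j → M ℕ.< j ℕ.+ i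
    bound m≤j = ℕₚ.<-≤-trans (ℕₚ.≤-<-trans (ℕₚ.m≤n+m∸n M i) (ℕₚ.+-monoʳ-< i M∸i<m))
                             (ℕₚ.≤-trans (ℕₚ.≤-reflexive (ℕₚ.+-comm i m)) (ℕₚ.+-monoˡ-≤ i m≤j))

lemma4p16 : (N : ℕ) → (J₁ ⊛ U) N ≡ RHS N
lemma4p16 zero    = refl
lemma4p16 (suc M) = begin
  (J₁ ⊛ U) (suc M)
    ≡⟨ J₁-⊛-U-double-sum (suc M) ⟩
  sumTo (suc M) (λ i → sumTo (suc M) (λ j → term i j (suc M)))
    ≡⟨ sumTo-extend _ (ℕₚ.n≤1+n M) (λ i M<i → sumTo-zero (suc M) _ (λ j _ → term-vanishˡ i j M<i)) ⟩
  sumTo M (λ i → sumTo (suc M) (λ j → term i j (suc M)))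
    ≡⟨ sumTo-cong M (λ i → sumTo-extend _ (ℕₚ.n≤1+n M) (λ j M<j → term-vanishʳ i j M<j)) ⟩
  sumTo M (λ i → sumTo M (λ j → term i j (suc M)))
    ≡⟨ sym (RHS-double-sum M) ⟩
  RHS (suc M) ∎
  where open ≡-Reasoning
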